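{- Let $G$ be a graph and let $\mathcal{P}$ be a grid-like-minor (of any order) in $G$. Then the intersection graph $H$ of $\mathcal{P}$ is a minor of $G\,\square\,K_2$.
   Context: All graphs are finite, simple and undirected. The intersection graph of a set $\mathcal{P}$ of subgraphs of $G$ is the graph with vertex set $\mathcal{P}$ in which two distinct members are adjacent iff they share a vertex. A grid-like-minor of order $\ell$ in $G$ is a set $\mathcal{P}$ of paths in $G$ whose intersection graph is bipartite and contains $K_\ell$ as a minor. The cartesian product $G\,\square\,K_2$ consists of two disjoint copies of $G$ plus an edge joining each vertex of the first copy to the corresponding vertex of the second copy. -}

module Defs where

open import Data.Nat using (ℕ)
open import Data.Fin using (Fin)
open import Data.Bool using (Bool; true; false)
open import Data.Empty using (⊥)
open import Data.Product using (Σ; ∃; ∃₂; _×_; _,_)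
open import Data.Sum using (_⊎_; inj₁; inj₂)
open import Data.List using (List; []; _∷_)
open import Data.List.Membership.Propositional using (_∈_)
open import Data.List.Relation.Unary.Linked using (Linked)
open import Data.List.Relation.Unary.Unique.Propositional using (Unique)
open import Relation.Binary.PropositionalEquality using (_≡_; _≢_; sym)
open import Relation.Nullary using (¬_)
open import Function.Bundles using (_↔_)

record Graph : Set₁ where
  field
    V     : Set
    _~_   : V → V → Set
    ~-sym : ∀ {u v} → u ~ v → v ~ u
    ~-irr : ∀ {u} → ¬ (u ~ u)
open Graph public

Finite : Graph → Set
Finite G = ∃ λ n → V G ↔ Fin n

_⇔_ : Set → Set → Set
A ⇔ B = (A → B) × (B → A)

record Path (G : Graph) : Set where
  field
    verts    : List (V G)
    nonempty : verts ≢ []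
    linked   : Linked (_~_ G) verts
    distinct : Unique verts
open Path public

Consec : {A : Set} → List A → A → A → Set
Consec []             u v = ⊥
Consec (a ∷ [])       u v = ⊥
Consec (a ∷ b ∷ xs)   u v = (u ≡ a × v ≡ b) ⊎ Consec (b ∷ xs) u v

VertexOf : {G : Graph} → Path G → V G → Set
VertexOf p v = v ∈ verts p

EdgeOf : {G : Graph} → Path G → V G → V G → Set
EdgeOf p u v = Consec (verts p) u v ⊎ Consec (verts p) v u

SameSubgraph : {G : Graph} → Path G → Path G → Set
SameSubgraph p q =
  (∀ v → VertexOf p v ⇔ VertexOf q v) × (∀ u v → EdgeOf p u v ⇔ EdgeOf q u v)

record PathSet (G : Graph) : Set where
  field
    size    : ℕ
    path    : Fin size → Path G
    members-distinct : ∀ i j → i ≢ j → ¬ SameSubgraph (path i) (path j)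
open PathSet public

IntersectionGraph : {G : Graph} → PathSet G → Graph
IntersectionGraph {G} 𝒫 = record
  { V     = Fin (size 𝒫)
  ; _~_   = λ i j → i ≢ j × (∃ λ v → VertexOf (path 𝒫 i) v × VertexOf (path 𝒫 j) v)
  ; ~-sym = λ { (i≢j , v , a , b) → (λ e → i≢j (sym e)) , v , b , a }
  ; ~-irr = λ { (i≢i , _) → i≢i Relation.Binary.PropositionalEquality.refl }
  }

Bipartite : Graph → Set
Bipartite H = Σ (V H → Bool) λ c → ∀ {x y} → _~_ H x y → c x ≢ c y

K : ℕ → Graph
K ℓ = record
  { V = Fin ℓ ; _~_ = λ i j → i ≢ j
  ; ~-sym = λ i≢j e → i≢j (sym e)
  ; ~-irr = λ i≢i → i≢i Relation.Binary.PropositionalEquality.refl }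

data WalkIn (G : Graph) (S : V G → Set) : V G → V G → Set where
  here : ∀ {u} → S u → WalkIn G S u u
  step : ∀ {u w v} → S u → _~_ G u w → WalkIn G S w v → WalkIn G S u v

Connected : (G : Graph) → (V G → Set) → Set
Connected G S = ∀ u v → S u → S v → WalkIn G S u v

record MinorModel (H G : Graph) : Set₁ where
  field
    branch    : V H → V G → Set
    nonempty  : ∀ x → ∃ λ v → branch x v
    disjoint  : ∀ x y v → branch x v → branch y v → x ≡ y
    connected : ∀ x → Connected G (branch x)
    edges     : ∀ {x y} → _~_ H x y →
                ∃₂ λ u v → branch x u × branch y v × _~_ G u v

_≼_ : Graph → Graph → Set₁
H ≼ G = MinorModel H G

GridLikeMinor : (G : Graph) → ℕ → PathSet G → Set₁
GridLikeMinor G ℓ 𝒫 = Bipartite (IntersectionGraph 𝒫) × (K ℓ ≼ IntersectionGraph 𝒫)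

-- Cartesian product G □ K₂ : vertices (v , b), b : Bool selects the copy
_□K₂ : Graph → Graph
G □K₂ = record
  { V = V G × Bool
  ; _~_ = λ { (u , a) (v , b) → (a ≡ b × _~_ G u v) ⊎ (u ≡ v × a ≢ b) }
  ; ~-sym = λ { (inj₁ (e , uv)) → inj₁ (sym e , ~-sym G uv)
              ; (inj₂ (e , ne)) → inj₂ (sym e , λ x → ne (sym x)) }
  ; ~-irr = λ { (inj₁ (_ , uu)) → ~-irr G uu
              ; (inj₂ (_ , ne)) → ne Relation.Binary.PropositionalEquality.refl } }

module Submission where

-- Let c be a proper 2-colouring of the intersection graph H of 𝒫.
-- Model each path P_x as the copy of its vertex set in layer c(x) of G □ K₂.
--  * Branch sets are connected: the vertex list of a path is linked, hence
--    induces a connected subgraph of G, and walks of G lift to any layer.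
--  * Branch sets are disjoint: two paths meeting in a vertex are adjacent in H,
--    so they receive different colours and live in different layers.
--  * Adjacent members x, y of H share a vertex v, and the rung (v , c x) —
--    (v , c y) of G □ K₂ joins their branch sets since c x ≢ c y.

open import Defs
open import Data.Nat using (ℕ)
open import Data.Fin using (_≟_)
open import Data.Bool using (Bool)
open import Data.Empty using (⊥-elim)
open import Data.Product using (∃; _×_; _,_; proj₁)
open import Data.Sum using (inj₁; inj₂)
open import Data.List using ([]; _∷_)
open import Data.List.Membership.Propositional using (_∈_)
open import Data.List.Relation.Unary.Any using (here; there)
open import Data.List.Relation.Unary.Linked using (Linked; _∷_)
open import Relation.Binary.PropositionalEquality using (_≡_; refl; sym; trans)
open import Relation.Nullary using (yes; no)

module Walks (G : Graph) where

  walk-++ : ∀ {S u w v} → WalkIn G S u w → WalkIn G S w v → WalkIn G S u v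
  walk-++ (here _)     q = q
  walk-++ (step s e p) q = step s e (walk-++ p q)

  walk-start : ∀ {S u v} → WalkIn G S u v → S u
  walk-start (here s)     = s
  walk-start (step s _ _) = s

  walk-reverse : ∀ {S u v} → WalkIn G S u v → WalkIn G S v u
  walk-reverse (here s)     = here s
  walk-reverse (step s e p) =
    walk-++ (walk-reverse p) (step (walk-start p) (~-sym G e) (here s))

  walk-mono : ∀ {S T : V G → Set} → (∀ {w} → S w → T w) →
              ∀ {u v} → WalkIn G S u v → WalkIn G T u v
  walk-mono S⊆T (here s)     = here (S⊆T s)
  walk-mono S⊆T (step s e p) = step (S⊆T s) e (walk-mono S⊆T p)

  walk-from-head : ∀ {a xs} → Linked (_~_ G) (a ∷ xs) →
                   ∀ {v} → v ∈ a ∷ xs → WalkIn G (λ w → w ∈ a ∷ xs) a v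
  walk-from-head _ (here refl) = here (here refl)
  walk-from-head {xs = _ ∷ _} (a~b ∷ linked) (there v∈) =
    step (here refl) a~b (walk-mono there (walk-from-head linked v∈))

  -- The entries of a linked list induce a connected subgraph: go back to the
  -- head, then forward.
  linked-connected : ∀ {l} → Linked (_~_ G) l → Connected G (λ w → w ∈ l)
  linked-connected {[]}    _      _ _ ()
  linked-connected {_ ∷ _} linked _ _ u∈ v∈ =
    walk-++ (walk-reverse (walk-from-head linked u∈)) (walk-from-head linked v∈)

  path-connected : (p : Path G) → Connected G (VertexOf p)
  path-connected p = linked-connected (linked p)

open Walks using (path-connected)

path-has-vertex : {G : Graph} (p : Path G) → ∃ (VertexOf p)
path-has-vertex p with verts p | nonempty p
... | []    | ne = ⊥-elim (ne refl)
... | a ∷ _ | _  = a , here refl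

Layer : (G : Graph) → Bool → (V G → Set) → V (G □K₂) → Set
Layer G b S (v , b′) = b′ ≡ b × S v

lift-walk : (G : Graph) {b : Bool} {S : V G → Set} → ∀ {u v} →
            WalkIn G S u v → WalkIn (G □K₂) (Layer G b S) (u , b) (v , b)
lift-walk G (here s)     = here (refl , s)
lift-walk G (step s e p) = step (refl , s) (inj₁ (refl , e)) (lift-walk G p)

layer-connected : (G : Graph) {b : Bool} {S : V G → Set} →
                  Connected G S → Connected (G □K₂) (Layer G b S)
layer-connected G conn (u , _) (v , _) (refl , u∈S) (refl , v∈S) =
  lift-walk G (conn u v u∈S v∈S)

same-colour-disjoint : {G : Graph} (𝒫 : PathSet G) (c : Bipartite (IntersectionGraph 𝒫)) →
                       ∀ x y v → VertexOf (path 𝒫 x) v → VertexOf (path 𝒫 y) v →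
                       proj₁ c x ≡ proj₁ c y → x ≡ y
same-colour-disjoint 𝒫 (c , proper) x y v v∈x v∈y same with x ≟ y
... | yes x≡y = x≡y
... | no  x≢y = ⊥-elim (proper (x≢y , v , v∈x , v∈y) same)

bipartite-intersection-minor : (G : Graph) (𝒫 : PathSet G) →
                               Bipartite (IntersectionGraph 𝒫) →
                               IntersectionGraph 𝒫 ≼ (G □K₂)
bipartite-intersection-minor G 𝒫 (c , proper) = record
  { branch    = λ x → Layer G (c x) (VertexOf (path 𝒫 x))
  ; nonempty  = λ x → let (v , v∈) = path-has-vertex (path 𝒫 x) in (v , c x) , refl , v∈
  ; disjoint  = λ { x y (v , _) (b≡cx , v∈x) (b≡cy , v∈y) →
                    same-colour-disjoint 𝒫 (c , proper) x y v v∈x v∈y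
                      (trans (sym b≡cx) b≡cy) }
  ; connected = λ x → layer-connected G (path-connected G (path 𝒫 x))
  ; edges     = λ { {x} {y} x~y@(_ , v , v∈x , v∈y) →
                    (v , c x) , (v , c y) , (refl , v∈x) , (refl , v∈y) , inj₂ (refl , proper x~y) }
  }

lemma9 : (G : Graph) → Finite G → (𝒫 : PathSet G) → (ℓ : ℕ) →
         GridLikeMinor G ℓ 𝒫 → IntersectionGraph 𝒫 ≼ (G □K₂)
lemma9 G _ 𝒫 _ (bipartite , _) = bipartite-intersection-minor G 𝒫 bipartite
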